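{- Let $b\ge 2$ be an integer, let $n\ge 1$, and let $D=\{d_0,\dots,d_{n-1}\}$ be a set of integers with $0=d_0<d_1<\dots<d_{n-1}$. Let $\mathbb{Z}_b[D]$ be the set of integers of the form $\sum_{i=0}^{n-1}a_ib^{d_i}$ with all $a_i\in\{0,1,\dots,b-1\}$. Then for \[ m=\left\lceil \log_b\big((2b-1)^n-1\big)\right\rceil \] there exist a non-negative integer $\mu$ and a non-negative integer $k$ such that the map $\mathbb{Z}_b[D]\to\{0,1,\dots,b-1\}^m$, $a\mapsto \mathrm{dig}(a\mu)_{k,m}$, is injective. Furthermore, if $D$ is the union of pairwise disjoint integer intervals $\{c_i,c_i+1,\dots,c_i+\ell_i-1\}$ for $i=1,\dots,r$ with all $\ell_i\ge 1$, then the same conclusion holds with \[ m=\left\lceil \log_b\Big(\prod_{i=1}^{r}(2b^{\ell_i}-1)-1\Big)\right\rceil. \]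
   Context: For a non-negative integer $x=\sum_{i\ge 0}x_ib^i$ written in base $b$ (digits $x_i\in\{0,\dots,b-1\}$, all but finitely many zero), and integers $k\ge 0$, $m\ge 1$, $\mathrm{dig}(x)_{k,m}$ denotes the $m$-tuple of base-$b$ digits $(x_{k+m-1},\dots,x_{k+1},x_k)\in\{0,1,\dots,b-1\}^m$. -}

module Defs where

open import Data.Nat using (ℕ; zero; suc; _+_; _*_; _∸_; _^_; _≤_; _<_)
open import Data.Nat.DivMod using (_/_; _%_)
open import Data.Fin using (Fin; toℕ) renaming (zero to fzero; suc to fsuc; _<_ to _<ᶠ_)
open import Data.Vec using (Vec; tabulate)
open import Data.Product using (Σ; _×_; ∃; ∃-syntax)
open import Relation.Binary.PropositionalEquality using (_≡_)

∑ : (n : ℕ) → (Fin n → ℕ) → ℕ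
∑ zero    f = 0
∑ (suc n) f = f fzero + ∑ n (λ i → f (fsuc i))

∏ : (n : ℕ) → (Fin n → ℕ) → ℕ
∏ zero    f = 1
∏ (suc n) f = f fzero * ∏ n (λ i → f (fsuc i))

-- digit b x i = x_i, the i-th base-b digit of x (meaningful for b ≥ 2;
-- the b = 0 clause is junk and never used).
digit : ℕ → ℕ → ℕ → ℕ
digit zero    x i       = 0
digit (suc b) x zero    = x % suc b
digit (suc b) x (suc i) = digit (suc b) (x / suc b) i

-- dig(x)_{k,m} = (x_{k+m-1}, ..., x_{k+1}, x_k); position j holds x_{k+m-1-j}.
dig : (b x k m : ℕ) → Vec ℕ m
dig b x k m = tabulate (λ j → digit b x (k + (m ∸ suc (toℕ j))))

IsCeilLog : (b N m : ℕ) → Set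
IsCeilLog b N m = (N ≤ b ^ m) × (∀ j → N ≤ b ^ j → m ≤ j)

StrictlyIncreasing : {n : ℕ} → (Fin n → ℕ) → Set
StrictlyIncreasing {n} d = ∀ (i j : Fin n) → i <ᶠ j → d i < d j

InZbD : (b n : ℕ) → (Fin n → ℕ) → ℕ → Set
InZbD b n d x = Σ (Fin n → ℕ) (λ a → (∀ i → a i < b) × (x ≡ ∑ n (λ i → a i * b ^ d i)))

DigInjective : (b n : ℕ) → (Fin n → ℕ) → (m μ k : ℕ) → Set
DigInjective b n d m μ k =
  ∀ x y → InZbD b n d x → InZbD b n d y → dig b (x * μ) k m ≡ dig b (y * μ) k m → x ≡ y

InD : {n : ℕ} → (Fin n → ℕ) → ℕ → Set
InD {n} d x = ∃[ i ] (x ≡ d i)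

InInterval : ℕ → ℕ → ℕ → Set
InInterval c ℓ x = (c ≤ x) × (x < c + ℓ)

{-# OPTIONS --safe #-}
-- Write B = b^(k+m) and h = b^k. If aμ and a′μ (a > a′) have the same digits in positions
-- k, …, k+m−1, then (a − a′)μ or (a′ − a)μ has residue below h modulo B. Grouping the digits
-- of a ∈ ℤ_b[D] along the intervals writes a = ∑ A_j b^(c_j) with A_j < b^(ℓ_j), so the nonzero
-- differences a − a′ form a list of at most M − 1 ≤ b^m integers δ, where M = ∏ (2b^(ℓ_j) − 1),
-- each with |δ| ≤ V = ∑ (b^(ℓ_j) − 1) b^(c_j). For one δ at most h + V − 1 multipliers μ < B give
-- δμ a residue below h, and when wV ≤ h every μ < w (resp. μ > B − w) does so for all positive
-- (resp. negative) δ. Counting these 2w − 1 multipliers only once, the union bound leaves a good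
-- μ < B once w ≥ b^m V and h ≥ w(V + 3). The first claim is the case of the singletons {d_i}.
module Submission where

open import Defs
open import Level using (0ℓ)
open import Function using (_∘_)
open import Function.Bundles using (_⇔_; Equivalence)
open import Data.Nat
open import Data.Nat.Properties
open import Data.Nat.DivMod
open import Data.Nat.Divisibility using (_∣_; _∣?_; divides; n∣n; m∣m*n; >⇒∤; ∣m+n∣m⇒∣n; ∣m∣n⇒∣m+n; ∣n⇒∣m*n)
open import Data.Nat.ListAction using (sum)
open import Data.Nat.Tactic.RingSolver using (solve; solve-∀)
open import Data.Integer as ℤ using (ℤ; -[1+_]; ∣_∣)
import Data.Integer.Properties as ℤP
import Data.Integer.Tactic.RingSolver as ℤ-Solver
open import Data.Fin using (Fin; toℕ; fromℕ<) renaming (zero to fzero; suc to fsuc)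
import Data.Fin.Properties as FinP
open import Data.Vec using (lookup)
open import Data.Vec.Properties using (lookup∘tabulate)
open import Data.List using (List; []; _∷_; _++_; map; upTo; length; filter; cartesianProductWith)
open import Data.List.Properties using (length-++; length-map; length-upTo; filter-notAll)
open import Data.List.Membership.Propositional using (_∈_; lose)
open import Data.List.Membership.Propositional.Properties
  using (∈-filter⁺; ∈-filter⁻; ∈-++⁺ˡ; ∈-++⁺ʳ; ∈-++⁻; ∈-map⁺; ∈-map⁻; ∈-upTo⁺; ∈-upTo⁻; ∈-cartesianProductWith⁺; ∈-cartesianProductWith⁻)
open import Data.List.Relation.Unary.All as All using (All)
open import Data.List.Relation.Unary.All.Properties using (¬Any⇒All¬)
open import Data.List.Relation.Unary.Any as Any using (Any; here; any?; toSum)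
open import Data.Product using (Σ; _×_; _,_; proj₁; proj₂; ∃-syntax)
open import Data.Sum using (_⊎_; inj₁; inj₂; [_,_])
open import Relation.Binary.PropositionalEquality using (_≡_; _≢_; refl; sym; trans; cong; cong₂; subst; subst₂; module ≡-Reasoning)
open import Relation.Binary.Definitions using (tri<; tri≈; tri>)
open import Relation.Nullary using (¬_; Dec; yes; no; contradiction)
open import Relation.Nullary.Decidable using (_×-dec_; _⊎-dec_; ¬?)
open import Relation.Unary using (Pred; Decidable)
import Algebra.Properties.Semiring.Sum +-*-semiring as FinSum
open import Algebra.Properties.CommutativeSemigroup +-commutativeSemigroup using (interchange)

∑≡sum : ∀ n (f : Fin n → ℕ) → ∑ n f ≡ FinSum.sum f
∑≡sum zero    f = refl
∑≡sum (suc n) f = cong (f fzero +_) (∑≡sum n (λ i → f (fsuc i)))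

∑-cong : ∀ n {f g : Fin n → ℕ} → (∀ i → f i ≡ g i) → ∑ n f ≡ ∑ n g
∑-cong n {f} {g} f≗g = trans (∑≡sum n f) (trans (FinSum.sum-cong-≗ f≗g) (sym (∑≡sum n g)))

∑-*ʳ : ∀ n (f : Fin n → ℕ) K → ∑ n f * K ≡ ∑ n (λ i → f i * K)
∑-*ʳ n f K = trans (cong (_* K) (∑≡sum n f)) (trans (FinSum.*-distribʳ-sum K f) (sym (∑≡sum n _)))

∑-comm : ∀ r n (f : Fin r → Fin n → ℕ) → ∑ r (λ j → ∑ n (f j)) ≡ ∑ n (λ i → ∑ r (λ j → f j i))
∑-comm r n f = begin
  ∑ r (λ j → ∑ n (f j))                        ≡⟨ ∑-cong r (λ j → ∑≡sum n (f j)) ⟩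
  ∑ r (λ j → FinSum.sum (f j))                 ≡⟨ ∑≡sum r _ ⟩
  FinSum.sum (λ j → FinSum.sum (f j))          ≡⟨ FinSum.∑-comm f ⟩
  FinSum.sum (λ i → FinSum.sum (λ j → f j i))  ≡⟨ ∑≡sum n _ ⟨
  ∑ n (λ i → FinSum.sum (λ j → f j i))         ≡⟨ ∑-cong n (λ i → ∑≡sum r (λ j → f j i)) ⟨
  ∑ n (λ i → ∑ r (λ j → f j i)) ∎
  where open ≡-Reasoning

∑-single : ∀ r (f : Fin r → ℕ) j₀ → (∀ j → j ≢ j₀ → f j ≡ 0) → ∑ r f ≡ f j₀
∑-single (suc r) f fzero      others = begin
  f fzero + ∑ r (λ j → f (fsuc j))  ≡⟨ cong (f fzero +_) (∑-cong r (λ j → others (fsuc j) λ ())) ⟩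
  f fzero + ∑ r (λ _ → 0)           ≡⟨ cong (f fzero +_) (trans (∑≡sum r _) (FinSum.sum-replicate-zero r)) ⟩
  f fzero + 0                       ≡⟨ +-identityʳ (f fzero) ⟩
  f fzero ∎
  where open ≡-Reasoning
∑-single (suc r) f (fsuc j₀) others =
  cong₂ _+_ (others fzero λ ()) (∑-single r (λ j → f (fsuc j)) j₀ (λ j j≢j₀ → others (fsuc j) (j≢j₀ ∘ FinP.suc-injective)))

∏-const : ∀ n K → ∏ n (λ _ → K) ≡ K ^ n
∏-const zero    K = refl
∏-const (suc n) K = cong (K *_) (∏-const n K)

1≤∏ : ∀ r (f : Fin r → ℕ) → (∀ j → 1 ≤ f j) → 1 ≤ ∏ r f
1≤∏ zero    f _    = ≤-refl
1≤∏ (suc r) f 1≤f = *-mono-≤ (1≤f fzero) (1≤∏ r (f ∘ fsuc) (1≤f ∘ fsuc))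

-- Counting over initial segments of ℕ

module Counting where

  private variable
    P Q : Pred ℕ 0ℓ

  indicator : {A : Set} → Dec A → ℕ
  indicator (yes _) = 1
  indicator (no _)  = 0

  indicator-mono : {A C : Set} (a? : Dec A) (c? : Dec C) → (A → C) → indicator a? ≤ indicator c?
  indicator-mono (yes a) (yes _) A⇒C = ≤-refl
  indicator-mono (yes a) (no ¬c) A⇒C = contradiction (A⇒C a) ¬c
  indicator-mono (no _)  _       A⇒C = z≤n

  indicator-cong : {A C : Set} (a? : Dec A) (c? : Dec C) → (A → C) → (C → A) → indicator a? ≡ indicator c?
  indicator-cong a? c? A⇒C C⇒A = ≤-antisym (indicator-mono a? c? A⇒C) (indicator-mono c? a? C⇒A)

  indicator-yes : {A : Set} (a? : Dec A) → A → indicator a? ≡ 1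
  indicator-yes (yes _) _ = refl
  indicator-yes (no ¬a) a = contradiction a ¬a

  indicator-×-yes : {A C : Set} (a? : Dec A) (c? : Dec C) → A → indicator (a? ×-dec c?) ≡ indicator c?
  indicator-×-yes (yes _) (yes _) _ = refl
  indicator-×-yes (yes _) (no _)  _ = refl
  indicator-×-yes (no ¬a) _       a = contradiction a ¬a

  count : Decidable P → ℕ → ℕ
  count P? zero    = 0
  count P? (suc n) = count P? n + indicator (P? n)

  count-mono : (P? : Decidable P) (Q? : Decidable Q) → ∀ n → (∀ i → i < n → P i → Q i) → count P? n ≤ count Q? n
  count-mono P? Q? zero    P⇒Q = z≤n
  count-mono P? Q? (suc n) P⇒Q =
    +-mono-≤ (count-mono P? Q? n (λ i i<n → P⇒Q i (m<n⇒m<1+n i<n))) (indicator-mono (P? n) (Q? n) (P⇒Q n ≤-refl))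

  count-cong : (P? : Decidable P) (Q? : Decidable Q) → ∀ n →
               (∀ i → i < n → P i → Q i) → (∀ i → i < n → Q i → P i) → count P? n ≡ count Q? n
  count-cong P? Q? n P⇒Q Q⇒P = ≤-antisym (count-mono P? Q? n P⇒Q) (count-mono Q? P? n Q⇒P)

  count-+ : (P? : Decidable P) → ∀ a c → count P? (a + c) ≡ count P? a + count (λ t → P? (a + t)) c
  count-+ P? a zero    = trans (cong (count P?) (+-identityʳ a)) (sym (+-identityʳ _))
  count-+ P? a (suc c) rewrite +-suc a c | count-+ P? a c =
    +-assoc (count P? a) (count (λ t → P? (a + t)) c) _

  count-suc : (P? : Decidable P) → ∀ n → count P? (suc n) ≡ indicator (P? 0) + count (λ i → P? (suc i)) n
  count-suc P? = count-+ P? 1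

  count-all : (P? : Decidable P) → ∀ n → (∀ i → i < n → P i) → count P? n ≡ n
  count-all P? zero    _   = refl
  count-all P? (suc n) all with P? n
  ... | yes _  = trans (cong (_+ 1) (count-all P? n (λ i i<n → all i (m<n⇒m<1+n i<n)))) (+-comm n 1)
  ... | no ¬Pn = contradiction (all n ≤-refl) ¬Pn

  count-none : (P? : Decidable P) → ∀ n → (∀ i → i < n → ¬ P i) → count P? n ≡ 0
  count-none P? zero    _    = refl
  count-none P? (suc n) none with P? n
  ... | yes Pn = contradiction Pn (none n ≤-refl)
  ... | no _   = trans (+-identityʳ _) (count-none P? n (λ i i<n → none i (m<n⇒m<1+n i<n)))

  count<⇒∃¬ : (P? : Decidable P) → ∀ n → count P? n < n → ∃[ i ] i < n × ¬ P i
  count<⇒∃¬ P? (suc n) c<n with P? n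
  ... | no ¬Pn = n , ≤-refl , ¬Pn
  ... | yes _  with count<⇒∃¬ P? n (≤-pred (subst (_< suc n) (+-comm (count P? n) 1) c<n))
  ...   | i , i<n , ¬Pi = i , m<n⇒m<1+n i<n , ¬Pi

  count-monoʳ : (P? : Decidable P) → ∀ {n N} → n ≤ N → count P? n ≤ count P? N
  count-monoʳ P? {n} {N} n≤N = begin
    count P? n                                       ≤⟨ m≤m+n _ _ ⟩
    count P? n + count (λ t → P? (n + t)) (N ∸ n)    ≡⟨ count-+ P? n (N ∸ n) ⟨
    count P? (n + (N ∸ n))                           ≡⟨ cong (count P?) (m+[n∸m]≡n n≤N) ⟩
    count P? N                                       ∎
    where open ≤-Reasoning

  count-reverse : (P? : Decidable P) → ∀ n → count (λ i → P? (n ∸ suc i)) n ≡ count P? n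
  count-reverse P? zero    = refl
  count-reverse P? (suc n) = begin
    count (λ i → P? (n ∸ i)) (suc n)                  ≡⟨ count-suc (λ i → P? (n ∸ i)) n ⟩
    indicator (P? n) + count (λ i → P? (n ∸ suc i)) n ≡⟨ cong (indicator (P? n) +_) (count-reverse P? n) ⟩
    indicator (P? n) + count P? n                     ≡⟨ +-comm _ (count P? n) ⟩
    count P? (suc n)                                  ∎
    where open ≡-Reasoning

  count-reindex : (P? : Decidable P) → ∀ {f g : ℕ → ℕ} n → (∀ i → i < n → f i ≡ g i) →
                  count (λ i → P? (f i)) n ≡ count (λ i → P? (g i)) n
  count-reindex {P} P? n f≡g = count-cong _ _ n (λ i i<n → subst P (f≡g i i<n)) (λ i i<n → subst P (sym (f≡g i i<n)))

  count-∪ : (P? : Decidable P) (Q? : Decidable Q) → ∀ n → count (λ i → P? i ⊎-dec Q? i) n ≤ count P? n + count Q? n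
  count-∪ P? Q? zero    = z≤n
  count-∪ P? Q? (suc n) = begin
    count (λ i → P? i ⊎-dec Q? i) n + indicator (P? n ⊎-dec Q? n)
      ≤⟨ +-mono-≤ (count-∪ P? Q? n) (indicator-∪ (P? n) (Q? n)) ⟩
    (count P? n + count Q? n) + (indicator (P? n) + indicator (Q? n))
      ≡⟨ interchange (count P? n) (count Q? n) _ _ ⟩
    count P? (suc n) + count Q? (suc n) ∎
    where
    open ≤-Reasoning
    indicator-∪ : {A C : Set} (a? : Dec A) (c? : Dec C) → indicator (a? ⊎-dec c?) ≤ indicator a? + indicator c?
    indicator-∪ (yes _) _       = s≤s z≤n
    indicator-∪ (no _)  (yes _) = ≤-refl
    indicator-∪ (no _)  (no _)  = z≤n

  count-any : {A : Set} {R : A → Pred ℕ 0ℓ} (R? : ∀ x → Decidable (R x)) → ∀ xs n →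
              count (λ μ → any? (λ x → R? x μ) xs) n ≤ sum (map (λ x → count (R? x) n) xs)
  count-any R? []       n = ≤-reflexive (count-none _ n (λ _ _ ()))
  count-any R? (x ∷ xs) n = begin
    count (λ μ → any? (λ x → R? x μ) (x ∷ xs)) n
      ≤⟨ count-mono _ (λ μ → R? x μ ⊎-dec any? (λ x → R? x μ) xs) n (λ _ _ → toSum) ⟩
    count (λ μ → R? x μ ⊎-dec any? (λ x → R? x μ) xs) n
      ≤⟨ count-∪ (R? x) _ n ⟩
    count (R? x) n + count (λ μ → any? (λ x → R? x μ) xs) n
      ≤⟨ +-monoʳ-≤ (count (R? x) n) (count-any R? xs n) ⟩
    sum (map (λ x → count (R? x) n) (x ∷ xs)) ∎
    where open ≤-Reasoning

  count-∩∁ : (P? : Decidable P) (Q? : Decidable Q) → ∀ n →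
             count P? n ≡ count (λ i → P? i ×-dec Q? i) n + count (λ i → P? i ×-dec ¬? (Q? i)) n
  count-∩∁ P? Q? zero    = refl
  count-∩∁ P? Q? (suc n) = begin
    count P? n + indicator (P? n)
      ≡⟨ cong₂ _+_ (count-∩∁ P? Q? n) (indicator-∩∁ (P? n) (Q? n)) ⟩
    (count (λ i → P? i ×-dec Q? i) n + count (λ i → P? i ×-dec ¬? (Q? i)) n)
      + (indicator (P? n ×-dec Q? n) + indicator (P? n ×-dec ¬? (Q? n)))
      ≡⟨ interchange (count (λ i → P? i ×-dec Q? i) n) _ _ _ ⟩
    count (λ i → P? i ×-dec Q? i) (suc n) + count (λ i → P? i ×-dec ¬? (Q? i)) (suc n) ∎
    where
    open ≡-Reasoning
    indicator-∩∁ : {A C : Set} (a? : Dec A) (c? : Dec C) → indicator a? ≡ indicator (a? ×-dec c?) + indicator (a? ×-dec ¬? c?)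
    indicator-∩∁ (yes _) (yes _) = refl
    indicator-∩∁ (yes _) (no _)  = refl
    indicator-∩∁ (no _)  _       = refl

  count-below : (P? : Decidable P) → ∀ {h} n → h ≤ n → count (λ s → P? s ×-dec s <? h) n ≡ count P? h
  count-below P? {h} n h≤n = begin
    count (λ s → P? s ×-dec s <? h) n
      ≡⟨ cong (count _) (m+[n∸m]≡n h≤n) ⟨
    count (λ s → P? s ×-dec s <? h) (h + (n ∸ h))
      ≡⟨ count-+ _ h (n ∸ h) ⟩
    count (λ s → P? s ×-dec s <? h) h + count (λ t → P? (h + t) ×-dec h + t <? h) (n ∸ h)
      ≡⟨ cong₂ _+_ (count-cong _ P? h (λ _ _ → proj₁) (λ _ i<h Pi → Pi , i<h))
                   (count-none _ (n ∸ h) (λ t _ → m+n≮m h t ∘ proj₂)) ⟩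
    count P? h + 0
      ≡⟨ +-identityʳ _ ⟩
    count P? h ∎
    where open ≡-Reasoning

  count-< : ∀ w n → w ≤ n → count (_<? w) n ≡ w
  count-< w n w≤n = begin
    count (_<? w) n                                 ≡⟨ cong (count _) (m+[n∸m]≡n w≤n) ⟨
    count (_<? w) (w + (n ∸ w))                     ≡⟨ count-+ _ w (n ∸ w) ⟩
    count (_<? w) w + count (λ t → w + t <? w) (n ∸ w)
      ≡⟨ cong₂ _+_ (count-all _ w (λ _ i<w → i<w)) (count-none _ (n ∸ w) (λ t _ → m+n≮m w t)) ⟩
    w + 0                                           ≡⟨ +-identityʳ w ⟩
    w ∎
    where open ≡-Reasoning

  count-> : ∀ a n → a < n → count (a <?_) n ≡ n ∸ suc a
  count-> a n a<n = begin
    count (a <?_) n                                         ≡⟨ cong (count _) (m+[n∸m]≡n a<n) ⟨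
    count (a <?_) (suc a + (n ∸ suc a))                     ≡⟨ count-+ _ (suc a) (n ∸ suc a) ⟩
    count (a <?_) (suc a) + count (λ t → a <? suc a + t) (n ∸ suc a)
      ≡⟨ cong₂ _+_ (count-none _ (suc a) (λ _ i≤a a<i → <-irrefl refl (<-≤-trans a<i (≤-pred i≤a))))
                   (count-all _ (n ∸ suc a) (λ t _ → s≤s (m≤m+n a t))) ⟩
    n ∸ suc a ∎
    where open ≡-Reasoning

  count-multiples-period : ∀ e a → count (λ t → suc e ∣? (a + t)) (suc e) ≡ 1
  count-multiples-period e zero = begin
    count (suc e ∣?_) (suc e)
      ≡⟨ count-suc _ e ⟩
    indicator (suc e ∣? 0) + count (λ i → suc e ∣? suc i) e
      ≡⟨ cong₂ _+_ (indicator-yes (suc e ∣? 0) (divides 0 refl)) (count-none _ e (λ i i<e → >⇒∤ (s≤s i<e))) ⟩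
    1 ∎
    where open ≡-Reasoning
  count-multiples-period e (suc a) = begin
    count (λ t → d ∣? (suc a + t)) e + indicator (d ∣? (suc a + e))
      ≡⟨ cong₂ _+_ (count-reindex (d ∣?_) e (λ t _ → sym (+-suc a t))) (indicator-cong _ _ ∣a+d⇒∣a ∣a⇒∣a+d) ⟩
    count (λ t → d ∣? (a + suc t)) e + indicator (d ∣? (a + 0))
      ≡⟨ +-comm _ (indicator (d ∣? (a + 0))) ⟩
    indicator (d ∣? (a + 0)) + count (λ t → d ∣? (a + suc t)) e
      ≡⟨ count-suc (λ t → d ∣? (a + t)) e ⟨
    count (λ t → d ∣? (a + t)) d
      ≡⟨ count-multiples-period e a ⟩
    1 ∎
    where
    open ≡-Reasoning
    d = suc e
    a+d≡ : suc a + e ≡ d + (a + 0)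
    a+d≡ = trans (sym (+-suc a e)) (trans (+-comm a d) (cong (d +_) (sym (+-identityʳ a))))
    ∣a+d⇒∣a : d ∣ suc a + e → d ∣ a + 0
    ∣a+d⇒∣a d∣ = ∣m+n∣m⇒∣n (subst (d ∣_) a+d≡ d∣) n∣n
    ∣a⇒∣a+d : d ∣ a + 0 → d ∣ suc a + e
    ∣a⇒∣a+d d∣a = subst (d ∣_) (sym a+d≡) (∣m∣n⇒∣m+n n∣n d∣a)

  count-multiples : ∀ e q a → count (λ t → suc e ∣? (a + t)) (q * suc e) ≡ q
  count-multiples e zero    a = refl
  count-multiples e (suc q) a = begin
    count (λ t → d ∣? (a + t)) (d + q * d)
      ≡⟨ count-+ _ d (q * d) ⟩
    count (λ t → d ∣? (a + t)) d + count (λ t → d ∣? (a + (d + t))) (q * d)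
      ≡⟨ cong₂ _+_ (count-multiples-period e a) (count-reindex (d ∣?_) (q * d) (λ t _ → sym (+-assoc a d t))) ⟩
    1 + count (λ t → d ∣? (a + d + t)) (q * d)
      ≡⟨ cong suc (count-multiples e q (a + d)) ⟩
    suc q ∎
    where
    open ≡-Reasoning
    d = suc e

  count-scale : (P? : Decidable P) → ∀ e X →
                count (λ μ → P? (suc e * μ)) X ≡ count (λ s → suc e ∣? s ×-dec P? s) (suc e * X)
  count-scale P? e zero    = cong (count _) (sym (*-zeroʳ (suc e)))
  count-scale P? e (suc X) = begin
    count (λ μ → P? (d * μ)) X + indicator (P? (d * X))
      ≡⟨ cong₂ _+_ (count-scale P? e X) (sym window) ⟩
    count Q? (d * X) + count (λ t → Q? (d * X + t)) d
      ≡⟨ count-+ Q? (d * X) d ⟨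
    count Q? (d * X + d)
      ≡⟨ cong (count Q?) (trans (+-comm (d * X) d) (sym (*-suc d X))) ⟩
    count Q? (d * suc X) ∎
    where
    open ≡-Reasoning
    d = suc e
    Q? = λ s → d ∣? s ×-dec P? s
    window : count (λ t → Q? (d * X + t)) d ≡ indicator (P? (d * X))
    window = begin
      count (λ t → Q? (d * X + t)) d
        ≡⟨ count-suc _ e ⟩
      indicator (Q? (d * X + 0)) + count (λ t → Q? (d * X + suc t)) e
        ≡⟨ cong₂ _+_ (cong (indicator ∘ Q?) (+-identityʳ (d * X)))
                     (count-none _ e (λ t t<e (d∣ , _) → >⇒∤ (s≤s t<e) (∣m+n∣m⇒∣n d∣ (m∣m*n X)))) ⟩
      indicator (Q? (d * X)) + 0
        ≡⟨ +-identityʳ _ ⟩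
      indicator (Q? (d * X))
        ≡⟨ indicator-×-yes (d ∣? d * X) (P? (d * X)) (m∣m*n X) ⟩
      indicator (P? (d * X)) ∎

  module _ (B : ℕ) .{{_ : NonZero B}} where

    count-multiples-mod< : ∀ e q h → h ≤ q * suc e → h ≤ B → ∀ j a →
                           count (λ s → suc e ∣? (a + s) ×-dec s % B <? h) (j * B) ≤ j * q
    count-multiples-mod< e q h h≤qd h≤B zero    a = z≤n
    count-multiples-mod< e q h h≤qd h≤B (suc j) a = begin
      count (λ s → d ∣? (a + s) ×-dec s % B <? h) (B + j * B)
        ≡⟨ count-+ _ B (j * B) ⟩
      count (λ s → d ∣? (a + s) ×-dec s % B <? h) B
        + count (λ t → d ∣? (a + (B + t)) ×-dec (B + t) % B <? h) (j * B)
        ≡⟨ cong₂ _+_ (count-cong _ _ B (λ s s<B (d∣ , lt) → d∣ , subst (_< h) (m<n⇒m%n≡m s<B) lt)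
                                       (λ s s<B (d∣ , lt) → d∣ , subst (_< h) (sym (m<n⇒m%n≡m s<B)) lt))
                     (count-cong _ _ (j * B) (λ t _ (d∣ , lt) → subst (d ∣_) (sym (+-assoc a B t)) d∣ , subst (_< h) (B+t%B t) lt)
                                             (λ t _ (d∣ , lt) → subst (d ∣_) (+-assoc a B t) d∣ , subst (_< h) (sym (B+t%B t)) lt)) ⟩
      count (λ s → d ∣? (a + s) ×-dec s <? h) B
        + count (λ t → d ∣? (a + B + t) ×-dec t % B <? h) (j * B)
        ≤⟨ +-mono-≤ first-block (count-multiples-mod< e q h h≤qd h≤B j (a + B)) ⟩
      q + j * q ∎
      where
      open ≤-Reasoning
      d = suc e
      B+t%B : ∀ t → (B + t) % B ≡ t % B
      B+t%B t = %-remove-+ˡ t n∣n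
      first-block : count (λ s → d ∣? (a + s) ×-dec s <? h) B ≤ q
      first-block = begin
        count (λ s → d ∣? (a + s) ×-dec s <? h) B ≡⟨ count-below (λ s → d ∣? (a + s)) B h≤B ⟩
        count (λ s → d ∣? (a + s)) h              ≤⟨ count-monoʳ (λ s → d ∣? (a + s)) h≤qd ⟩
        count (λ s → d ∣? (a + s)) (q * d)        ≡⟨ count-multiples e q a ⟩
        q ∎

    count-mul-mod< : ∀ e h → h ≤ B → count (λ μ → (suc e * μ) % B <? h) B ≤ h + e
    count-mul-mod< e h h≤B = begin
      count (λ μ → (d * μ) % B <? h) B              ≡⟨ count-scale (λ s → s % B <? h) e B ⟩
      count (λ s → d ∣? s ×-dec s % B <? h) (d * B) ≤⟨ count-multiples-mod< e q h h≤qd h≤B d 0 ⟩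
      d * q                                         ≡⟨ *-comm d q ⟩
      q * d                                         ≤⟨ m/n*n≤m (h + e) d ⟩
      h + e ∎
      where
      open ≤-Reasoning
      d = suc e
      q = (h + e) / d   -- ⌈h / d⌉
      h≤qd : h ≤ q * d
      h≤qd = +-cancelʳ-≤ e h (q * d) (begin
        h + e                   ≡⟨ m≡m%n+[m/n]*n (h + e) d ⟩
        (h + e) % d + q * d     ≤⟨ +-monoˡ-≤ (q * d) (≤-pred (m%n<n (h + e) d)) ⟩
        e + q * d               ≡⟨ +-comm e (q * d) ⟩
        q * d + e ∎)

  -- Negation modulo B on [0, B).
  reflect : ℕ → ℕ → ℕ
  reflect B zero    = zero
  reflect B (suc μ) = B ∸ suc μ

  count-reflect : (P? : Decidable P) → ∀ B → count (λ μ → P? (reflect B μ)) B ≡ count P? B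
  count-reflect P? zero     = refl
  count-reflect P? (suc B′) = begin
    count (λ μ → P? (reflect (suc B′) μ)) (suc B′)
      ≡⟨ count-suc _ B′ ⟩
    indicator (P? 0) + count (λ i → P? (B′ ∸ i)) B′
      ≡⟨ cong (indicator (P? 0) +_) (count-reindex P? B′ (λ i i<B′ → +-∸-assoc 1 i<B′)) ⟩
    indicator (P? 0) + count (λ i → P? (suc (B′ ∸ suc i))) B′
      ≡⟨ cong (indicator (P? 0) +_) (count-reverse (λ i → P? (suc i)) B′) ⟩
    indicator (P? 0) + count (λ i → P? (suc i)) B′
      ≡⟨ count-suc P? B′ ⟨
    count P? (suc B′) ∎
    where open ≡-Reasoning

  ∣reflect+ : ∀ B μ → μ ≤ B → B ∣ reflect B μ + μ
  ∣reflect+ B zero    _   = divides 0 refl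
  ∣reflect+ B (suc μ) μ≤B = subst (B ∣_) (sym (m∸n+n≡m μ≤B)) n∣n

open Counting

sum-map-bound : {A : Set} (f : A → ℕ) {K K′ : ℕ} → ∀ xs → All (λ x → f x + K ≤ K′) xs →
                sum (map f xs) + length xs * K ≤ length xs * K′
sum-map-bound f         []       All.[]             = z≤n
sum-map-bound f {K} {K′} (x ∷ xs) (fx≤ All.∷ rest) = begin
  (f x + sum (map f xs)) + (K + length xs * K)   ≡⟨ interchange (f x) _ K _ ⟩
  (f x + K) + (sum (map f xs) + length xs * K)   ≤⟨ +-mono-≤ fx≤ (sum-map-bound f xs rest) ⟩
  K′ + length xs * K′ ∎
  where open ≤-Reasoning

-- Base-b digit windows

digit-zero : ∀ b .{{_ : NonZero b}} X → digit b X 0 ≡ X % b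
digit-zero (suc _) X = refl

digit-suc : ∀ b .{{_ : NonZero b}} X i → digit b X (suc i) ≡ digit b (X / b) i
digit-suc (suc _) X i = refl

%-*-split : ∀ X h P .{{_ : NonZero h}} .{{_ : NonZero P}} →
            _%_ X (h * P) {{m*n≢0 h P}} ≡ X % h + h * (X / h % P)
%-*-split X h P = begin
  X % (h * P)                             ≡⟨ %-congʳ (*-comm h P) ⟩
  X % (P * h)                             ≡⟨ m≡m%n+[m/n]*n (X % (P * h)) h ⟩
  X % (P * h) % h + X % (P * h) / h * h   ≡⟨ cong₂ _+_ (m∣n⇒o%n%m≡o%m h (P * h) X (divides P refl))
                                                       (cong (_* h) (m%[n*o]/o≡m/o%n X P h)) ⟩
  X % h + X / h % P * h                   ≡⟨ cong (X % h +_) (*-comm _ h) ⟩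
  X % h + h * (X / h % P) ∎
  where
  open ≡-Reasoning
  instance
    _ = m*n≢0 P h
    _ = m*n≢0 h P

module _ (b : ℕ) .{{_ : NonZero b}} where

  digit-+ : ∀ X k .{{_ : NonZero (b ^ k)}} i → digit b X (k + i) ≡ digit b (X / b ^ k) i
  digit-+ X zero    i = cong (λ Z → digit b Z i) (sym (n/1≡n X))
  digit-+ X (suc k) i = begin
    digit b X (suc (k + i))      ≡⟨ digit-suc b X (k + i) ⟩
    digit b (X / b) (k + i)      ≡⟨ digit-+ (X / b) k i ⟩
    digit b (X / b / b ^ k) i    ≡⟨ cong (λ Z → digit b Z i) (m/n/o≡m/[n*o] X b (b ^ k)) ⟩
    digit b (X / b ^ suc k) i ∎
    where
    open ≡-Reasoning
    instance _ = m^n≢0 b k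

  digits⇒%≡ : ∀ m .{{_ : NonZero (b ^ m)}} X Y → (∀ i → i < m → digit b X i ≡ digit b Y i) → X % b ^ m ≡ Y % b ^ m
  digits⇒%≡ zero    X Y _     = trans (n%1≡0 X) (sym (n%1≡0 Y))
  digits⇒%≡ (suc m) X Y same = begin
    X % b ^ suc m                       ≡⟨ %-*-split X b (b ^ m) ⟩
    X % b + b * (X / b % b ^ m)         ≡⟨ cong₂ (λ r s → r + b * s) lowest rest ⟩
    Y % b + b * (Y / b % b ^ m)         ≡⟨ %-*-split Y b (b ^ m) ⟨
    Y % b ^ suc m ∎
    where
    open ≡-Reasoning
    instance _ = m^n≢0 b m
    lowest : X % b ≡ Y % b
    lowest = trans (sym (digit-zero b X)) (trans (same 0 z<s) (digit-zero b Y))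
    rest : X / b % b ^ m ≡ Y / b % b ^ m
    rest = digits⇒%≡ m (X / b) (Y / b)
      (λ i i<m → trans (sym (digit-suc b X i)) (trans (same (suc i) (s≤s i<m)) (digit-suc b Y i)))

  dig⇒digit : ∀ X Y k m → dig b X k m ≡ dig b Y k m → ∀ i → i < m → digit b X (k + i) ≡ digit b Y (k + i)
  dig⇒digit X Y k m same i i<m = begin
    digit b X (k + i)                   ≡⟨ cong (λ t → digit b X (k + t)) mirror ⟨
    digit b X (k + (m ∸ suc (toℕ j)))   ≡⟨ lookup∘tabulate (λ j → digit b X (k + (m ∸ suc (toℕ j)))) j ⟨
    lookup (dig b X k m) j              ≡⟨ cong (λ v → lookup v j) same ⟩
    lookup (dig b Y k m) j              ≡⟨ lookup∘tabulate (λ j → digit b Y (k + (m ∸ suc (toℕ j)))) j ⟩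
    digit b Y (k + (m ∸ suc (toℕ j)))   ≡⟨ cong (λ t → digit b Y (k + t)) mirror ⟩
    digit b Y (k + i) ∎
    where
    open ≡-Reasoning
    j = fromℕ< (∸-monoʳ-< {o = 0} z<s i<m)
    mirror : m ∸ suc (toℕ j) ≡ i
    mirror = begin
      m ∸ suc (toℕ j)        ≡⟨ cong (λ t → m ∸ suc t) (FinP.toℕ-fromℕ< _) ⟩
      m ∸ suc (m ∸ suc i)    ≡⟨ pred[m∸n]≡m∸[1+n] m (m ∸ suc i) ⟨
      pred (m ∸ (m ∸ suc i)) ≡⟨ cong pred (m∸[m∸n]≡n i<m) ⟩
      i ∎

  dig⇒window≡ : ∀ X Y k m .{{_ : NonZero (b ^ k)}} .{{_ : NonZero (b ^ m)}} →
                dig b X k m ≡ dig b Y k m → X / b ^ k % b ^ m ≡ Y / b ^ k % b ^ m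
  dig⇒window≡ X Y k m same = digits⇒%≡ m (X / b ^ k) (Y / b ^ k) λ i i<m →
    trans (sym (digit-+ X k i)) (trans (dig⇒digit X Y k m same i i<m) (digit-+ Y k i))

+-%-no-wrap : ∀ r v u B .{{_ : NonZero B}} → r < B → v ≤ u → (r + v) % B ≡ u → r + v ≡ u
+-%-no-wrap r v u B r<B v≤u r+v%B≡u with r + v <? B
... | yes r+v<B = trans (sym (m<n⇒m%n≡m r+v<B)) r+v%B≡u
... | no  r+v≮B = contradiction r<B (≤⇒≯ B≤r)
  where
  open ≤-Reasoning
  B≤r+v = ≮⇒≥ r+v≮B
  B≤r : B ≤ r
  B≤r = +-cancelʳ-≤ v B r (begin
    B + v                  ≡⟨ +-comm B v ⟩
    v + B                  ≤⟨ +-monoˡ-≤ B (begin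
      v                      ≤⟨ v≤u ⟩
      u                      ≡⟨ r+v%B≡u ⟨
      (r + v) % B            ≡⟨ m≤n⇒[n∸m]%m≡n%m B≤r+v ⟨
      (r + v ∸ B) % B        ≤⟨ m%n≤m (r + v ∸ B) B ⟩
      r + v ∸ B ∎) ⟩
    r + v ∸ B + B          ≡⟨ m∸n+n≡m B≤r+v ⟩
    r + v ∎)

-- Multipliers giving a difference a small residue

module _ (h P : ℕ) .{{_ : NonZero h}} .{{_ : NonZero P}} where

  private instance
    hP-nonZero : NonZero (h * P)
    hP-nonZero = m*n≢0 h P

  same-window⇒close : ∀ X Y s → X / h % P ≡ Y / h % P → Y % h ≤ X % h →
                      (s + Y) % (h * P) ≡ X % (h * P) → s % (h * P) < h
  same-window⇒close X Y s window≡ low≤ s+Y≡X = begin-strict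
    s % B                        ≤⟨ m≤m+n (s % B) (Y % h) ⟩
    s % B + Y % h                ≡⟨ +-cancelʳ-≡ (h * A) _ _ (begin-equality
      s % B + Y % h + h * A        ≡⟨ +-assoc (s % B) (Y % h) (h * A) ⟩
      s % B + (Y % h + h * A)      ≡⟨ cong (s % B +_) (sym Y%B) ⟩
      s % B + Y % B                ≡⟨ +-%-no-wrap (s % B) (Y % B) (X % B) B (m%n<n s B) Y%B≤X%B sum%B ⟩
      X % B                        ≡⟨ X%B ⟩
      X % h + h * A ∎) ⟩
    X % h                        <⟨ m%n<n X h ⟩
    h ∎
    where
    open ≤-Reasoning
    B = h * P
    A = X / h % P
    X%B : X % B ≡ X % h + h * A
    X%B = %-*-split X h P
    Y%B : Y % B ≡ Y % h + h * A
    Y%B = trans (%-*-split Y h P) (cong (λ a → Y % h + h * a) (sym window≡))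
    Y%B≤X%B : Y % B ≤ X % B
    Y%B≤X%B = subst₂ _≤_ (sym Y%B) (sym X%B) (+-monoˡ-≤ (h * A) low≤)
    sum%B : (s % B + Y % B) % B ≡ X % B
    sum%B = trans (sym (%-distribˡ-+ s Y B)) s+Y≡X

  -- δμ mod hP < h; for δ < 0 the residue of δμ is that of ∣δ∣ · (−μ).
  SmallResidue : ℤ → ℕ → Set
  SmallResidue (ℤ.+ n)    μ = (n * μ) % (h * P) < h
  SmallResidue -[1+ n ] μ = (suc n * reflect (h * P) μ) % (h * P) < h

  smallResidue? : ∀ δ → Decidable (SmallResidue δ)
  smallResidue? (ℤ.+ n)    μ = (n * μ) % (h * P) <? h
  smallResidue? -[1+ n ] μ = (suc n * reflect (h * P) μ) % (h * P) <? h

  same-window⇒small-residue : ∀ x y t μ → μ ≤ h * P → x ≡ y + suc t → (x * μ) / h % P ≡ (y * μ) / h % P →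
                              SmallResidue (ℤ.+ suc t) μ ⊎ SmallResidue -[1+ t ] μ
  same-window⇒small-residue x y t μ μ≤B refl window≡ with (y * μ) % h ≤? (x * μ) % h
  ... | yes Y≤X = inj₁ (same-window⇒close (x * μ) (y * μ) (suc t * μ) window≡ Y≤X
                          (cong (_% (h * P)) (trans (+-comm (suc t * μ) (y * μ)) (sym (*-distribʳ-+ μ y (suc t))))))
  ... | no  Y≰X = inj₂ (same-window⇒close (y * μ) (x * μ) (suc t * ν) (sym window≡) (<⇒≤ (≰⇒> Y≰X))
                          (trans (cong (_% (h * P)) wrap) (%-remove-+ˡ (y * μ) (∣n⇒∣m*n (suc t) (∣reflect+ (h * P) μ μ≤B)))))
    where
    ν = reflect (h * P) μ
    wrap : suc t * ν + (y + suc t) * μ ≡ suc t * (ν + μ) + y * μ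
    wrap = rearrange (suc t) ν y μ
      where
      rearrange : ∀ d ν y μ → d * ν + (y + d) * μ ≡ d * (ν + μ) + y * μ
      rearrange = solve-∀

-- The union bound

module SeparatingMultiplier (h P w V : ℕ) .{{_ : NonZero h}} .{{_ : NonZero P}}
                            (1≤w : 1 ≤ w) (w≤h : w ≤ h) (wV≤h : w * V ≤ h) where

  private
    B = h * P
    instance
      B-nonZero : NonZero B
      B-nonZero = m*n≢0 h P
    h≤B : h ≤ B
    h≤B = m≤m*n h P
    w≤B : w ≤ B
    w≤B = ≤-trans w≤h h≤B

  -- Every μ < w gives each positive δ with ∣δ∣ ≤ V a small residue, and every μ > B − w each
  -- negative one; counting this region once instead of once per δ is what makes the union bound fit.
  Edge : ℕ → Set
  Edge μ = μ < w ⊎ B ∸ w < μ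

  edge? : Decidable Edge
  edge? μ = μ <? w ⊎-dec B ∸ w <? μ

  count-edge : count edge? B + 1 ≤ w + w
  count-edge = begin
    count edge? B + 1                          ≤⟨ +-monoˡ-≤ 1 (count-∪ (_<? w) (B ∸ w <?_) B) ⟩
    count (_<? w) B + count (B ∸ w <?_) B + 1  ≡⟨ cong₂ (λ x y → x + y + 1) (count-< w B w≤B) (count-> (B ∸ w) B B∸w<B) ⟩
    w + (B ∸ suc (B ∸ w)) + 1                  ≡⟨ +-assoc w _ 1 ⟩
    w + (B ∸ suc (B ∸ w) + 1)                  ≡⟨ cong (w +_) (trans (+-comm _ 1) (sym (+-∸-assoc 1 B∸w<B))) ⟩
    w + (B ∸ (B ∸ w))                          ≡⟨ cong (w +_) (m∸[m∸n]≡n w≤B) ⟩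
    w + w ∎
    where
    open ≤-Reasoning
    B∸w<B : B ∸ w < B
    B∸w<B = ∸-monoʳ-< {o = 0} 1≤w w≤B

  private
    ∸-<-swap : ∀ x y .{{_ : NonZero x}} → x ≤ B → B ∸ x < y → B ∸ y < x
    ∸-<-swap x y x≤B B∸x<y = m<n+o⇒m∸n<o B y (begin-strict
      B               ≡⟨ m∸n+n≡m x≤B ⟨
      B ∸ x + x       <⟨ +-monoˡ-< x B∸x<y ⟩
      y + x ∎)
      where open ≤-Reasoning

  edge-reflect : ∀ μ → μ < B → Edge (reflect B μ) → Edge μ
  edge-reflect zero    _   e = e
  edge-reflect (suc μ) μ<B (inj₁ B∸μ<w)   = inj₂ (∸-<-swap (suc μ) w (<⇒≤ μ<B) B∸μ<w)
  edge-reflect (suc μ) μ<B (inj₂ B∸w<B∸μ) = inj₁ (∸-cancelʳ-< B∸w<B∸μ)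

  reflect-edge : ∀ μ → μ < B → Edge μ → Edge (reflect B μ)
  reflect-edge zero    _   e = e
  reflect-edge (suc μ) μ<B (inj₁ μ<w)   = inj₂ (∸-monoʳ-< μ<w w≤B)
  reflect-edge (suc μ) μ<B (inj₂ B∸w<μ) = inj₁ (∸-<-swap w (suc μ) {{>-nonZero 1≤w}} w≤B B∸w<μ)

  small-residue-below-w : ∀ e μ → μ < w → suc e ≤ V → SmallResidue h P (ℤ.+ suc e) μ
  small-residue-below-w e μ μ<w 1+e≤V = subst (_< h) (sym (m<n⇒m%n≡m (<-≤-trans eμ<h h≤B))) eμ<h
    where
    open ≤-Reasoning
    eμ<h : suc e * μ < h
    eμ<h = begin-strict
      suc e * μ   <⟨ *-monoʳ-< (suc e) μ<w ⟩
      suc e * w   ≤⟨ *-monoˡ-≤ w 1+e≤V ⟩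
      V * w       ≡⟨ *-comm V w ⟩
      w * V       ≤⟨ wV≤h ⟩
      h ∎

  SmallOffEdge : ℤ → ℕ → Set
  SmallOffEdge δ μ = SmallResidue h P δ μ × ¬ Edge μ

  smallOffEdge? : ∀ δ → Decidable (SmallOffEdge δ)
  smallOffEdge? δ μ = smallResidue? h P δ μ ×-dec ¬? (edge? μ)

  count-small-off-edge⁺ : ∀ e → suc e ≤ V → count (smallOffEdge? (ℤ.+ suc e)) B + (w + 1) ≤ h + V
  count-small-off-edge⁺ e 1+e≤V = begin
    off + (w + 1)              ≡⟨ trans (sym (+-assoc off w 1)) (cong (_+ 1) (+-comm off w)) ⟩
    w + off + 1                ≤⟨ +-monoˡ-≤ 1 (+-monoˡ-≤ off w≤on) ⟩
    on + off + 1               ≡⟨ cong (_+ 1) (count-∩∁ SR? edge? B) ⟨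
    count SR? B + 1            ≤⟨ +-monoˡ-≤ 1 (count-mul-mod< B e h h≤B) ⟩
    h + e + 1                  ≡⟨ trans (+-assoc h e 1) (cong (h +_) (+-comm e 1)) ⟩
    h + suc e                  ≤⟨ +-monoʳ-≤ h 1+e≤V ⟩
    h + V ∎
    where
    open ≤-Reasoning
    SR? = smallResidue? h P (ℤ.+ suc e)
    on  = count (λ μ → SR? μ ×-dec edge? μ) B
    off = count (smallOffEdge? (ℤ.+ suc e)) B
    w≤on : w ≤ on
    w≤on = begin
      w                   ≡⟨ count-< w B w≤B ⟨
      count (_<? w) B     ≤⟨ count-mono (_<? w) _ B (λ μ _ μ<w → small-residue-below-w e μ μ<w 1+e≤V , inj₁ μ<w) ⟩
      on ∎

  count-small-off-edge⁻ : ∀ e → count (smallOffEdge? -[1+ e ]) B ≡ count (smallOffEdge? (ℤ.+ suc e)) B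
  count-small-off-edge⁻ e = begin
    count (smallOffEdge? -[1+ e ]) B                                      ≡⟨ count-cong _ _ B
      (λ μ μ<B (small , ¬edge) → small , ¬edge ∘ edge-reflect μ μ<B)
      (λ μ μ<B (small , ¬edge) → small , ¬edge ∘ reflect-edge μ μ<B) ⟩
    count (λ μ → smallOffEdge? (ℤ.+ suc e) (reflect B μ)) B               ≡⟨ count-reflect (smallOffEdge? (ℤ.+ suc e)) B ⟩
    count (smallOffEdge? (ℤ.+ suc e)) B ∎
    where open ≡-Reasoning

  count-small-off-edge : ∀ δ → δ ≢ ℤ.+ 0 → ∣ δ ∣ ≤ V → count (smallOffEdge? δ) B + (w + 1) ≤ h + V
  count-small-off-edge (ℤ.+ zero)    δ≢0 _   = contradiction refl δ≢0
  count-small-off-edge (ℤ.+ suc e)   _   1+e≤V = count-small-off-edge⁺ e 1+e≤V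
  count-small-off-edge -[1+ e ]      _   1+e≤V =
    subst (λ c → c + (w + 1) ≤ h + V) (sym (count-small-off-edge⁻ e)) (count-small-off-edge⁺ e 1+e≤V)

  count-small-somewhere : ∀ Δ → count (λ μ → any? (λ δ → smallResidue? h P δ μ) Δ) B
                                ≤ count edge? B + sum (map (λ δ → count (smallOffEdge? δ) B) Δ)
  count-small-somewhere Δ = begin
    count (λ μ → any? (λ δ → smallResidue? h P δ μ) Δ) B
      ≤⟨ count-mono _ (λ μ → edge? μ ⊎-dec any? (λ δ → smallOffEdge? δ μ) Δ) B (λ μ _ → edge-or-off μ) ⟩
    count (λ μ → edge? μ ⊎-dec any? (λ δ → smallOffEdge? δ μ) Δ) B
      ≤⟨ count-∪ edge? _ B ⟩
    count edge? B + count (λ μ → any? (λ δ → smallOffEdge? δ μ) Δ) B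
      ≤⟨ +-monoʳ-≤ (count edge? B) (count-any smallOffEdge? Δ B) ⟩
    count edge? B + sum (map (λ δ → count (smallOffEdge? δ) B) Δ) ∎
    where
    open ≤-Reasoning
    edge-or-off : ∀ μ → Any (λ δ → SmallResidue h P δ μ) Δ → Edge μ ⊎ Any (λ δ → SmallOffEdge δ μ) Δ
    edge-or-off μ small with edge? μ
    ... | yes edge  = inj₁ edge
    ... | no  ¬edge = inj₂ (Any.map (_, ¬edge) small)

  ∃-separating-multiplier : ∀ Δ → All (λ δ → δ ≢ ℤ.+ 0 × ∣ δ ∣ ≤ V) Δ →
                            w + w + length Δ * (h + V) ≤ h * P + length Δ * (w + 1) →
                            ∃[ μ ] μ < h * P × All (λ δ → ¬ SmallResidue h P δ μ) Δ
  ∃-separating-multiplier Δ bounded room with count<⇒∃¬ (λ μ → any? (λ δ → smallResidue? h P δ μ) Δ) B bad<B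
    where
    L = length Δ
    S = sum (map (λ δ → count (smallOffEdge? δ) B) Δ)
    S-bound : S + L * (w + 1) ≤ L * (h + V)
    S-bound = sum-map-bound (λ δ → count (smallOffEdge? δ) B) Δ
                (All.map (λ (δ≢0 , δ≤V) → count-small-off-edge _ δ≢0 δ≤V) bounded)
    bad<B : count (λ μ → any? (λ δ → smallResidue? h P δ μ) Δ) B < B
    bad<B = +-cancelʳ-≤ (L * (w + 1)) _ _ (begin
      suc (count (λ μ → any? (λ δ → smallResidue? h P δ μ) Δ) B) + L * (w + 1)
        ≤⟨ +-monoˡ-≤ (L * (w + 1)) (s≤s (count-small-somewhere Δ)) ⟩
      suc (count edge? B + S) + L * (w + 1)
        ≡⟨ rearrange (count edge? B) S (L * (w + 1)) ⟩
      (count edge? B + 1) + (S + L * (w + 1))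
        ≤⟨ +-mono-≤ count-edge S-bound ⟩
      w + w + L * (h + V)
        ≤⟨ room ⟩
      B + L * (w + 1) ∎)
      where
      open ≤-Reasoning
      rearrange : ∀ c s x → suc (c + s) + x ≡ (c + 1) + (s + x)
      rearrange = solve-∀
  ... | μ , μ<B , none = μ , μ<B , ¬Any⇒All¬ Δ none

-- Choice of the parameters

n<b^n : ∀ b → 2 ≤ b → ∀ n → n < b ^ n
n<b^n b 2≤b zero    = s≤s z≤n
n<b^n b 2≤b (suc n) = begin-strict
  suc n          ≤⟨ n<b^n b 2≤b n ⟩
  b ^ n          <⟨ m<m+n (b ^ n) (≤-<-trans z≤n (n<b^n b 2≤b n)) ⟩
  b ^ n + b ^ n  ≡⟨ cong (b ^ n +_) (sym (+-identityʳ (b ^ n))) ⟩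
  2 * b ^ n      ≤⟨ *-monoˡ-≤ (b ^ n) 2≤b ⟩
  b ^ suc n ∎
  where open ≤-Reasoning

room-for-union-bound : ∀ h P w V L → L ≤ P → P * V ≤ w → w + w + P * V ≤ h →
                       L < P ⊎ 3 ≤ L ⊎ (V ≤ 1 × 2 ≤ L) →
                       w + w + L * (h + V) ≤ h * P + L * (w + 1)
room-for-union-bound h P w V L L≤P PV≤w room (inj₁ L<P) = begin
  w + w + L * (h + V)       ≡⟨ cong (w + w +_) (*-distribˡ-+ L h V) ⟩
  w + w + (L * h + L * V)   ≤⟨ +-monoʳ-≤ (w + w) (+-monoʳ-≤ (L * h) (*-monoˡ-≤ V L≤P)) ⟩
  w + w + (L * h + P * V)   ≡⟨ solve (w ∷ L ∷ h ∷ P ∷ V ∷ []) ⟩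
  (w + w + P * V) + L * h   ≤⟨ +-monoˡ-≤ (L * h) room ⟩
  suc L * h                 ≤⟨ *-monoˡ-≤ h L<P ⟩
  P * h                     ≡⟨ *-comm P h ⟩
  h * P                     ≤⟨ m≤m+n (h * P) _ ⟩
  h * P + L * (w + 1) ∎
  where open ≤-Reasoning
room-for-union-bound h P w V L L≤P PV≤w room (inj₂ (inj₁ 3≤L)) = begin
  w + w + L * (h + V)       ≡⟨ solve (w ∷ L ∷ h ∷ V ∷ []) ⟩
  w + w + L * V + L * h     ≤⟨ +-monoˡ-≤ (L * h) (+-monoʳ-≤ (w + w) (≤-trans (*-monoˡ-≤ V L≤P) PV≤w)) ⟩
  w + w + w + L * h         ≡⟨ solve (w ∷ L ∷ h ∷ V ∷ []) ⟩
  3 * w + L * h             ≤⟨ +-mono-≤ (*-monoˡ-≤ w 3≤L) (*-monoˡ-≤ h L≤P) ⟩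
  L * w + P * h             ≤⟨ +-mono-≤ (*-monoʳ-≤ L (m≤m+n w 1)) (≤-reflexive (*-comm P h)) ⟩
  L * (w + 1) + h * P       ≡⟨ +-comm _ (h * P) ⟩
  h * P + L * (w + 1) ∎
  where open ≤-Reasoning
room-for-union-bound h P w V L L≤P PV≤w room (inj₂ (inj₂ (V≤1 , 2≤L))) = begin
  w + w + L * (h + V)       ≡⟨ solve (w ∷ L ∷ h ∷ V ∷ []) ⟩
  2 * w + L * V + L * h     ≤⟨ +-monoˡ-≤ (L * h) (+-mono-≤ (*-monoˡ-≤ w 2≤L) (*-monoʳ-≤ L V≤1)) ⟩
  L * w + L * 1 + L * h     ≡⟨ cong (_+ L * h) (sym (*-distribˡ-+ L w 1)) ⟩
  L * (w + 1) + L * h       ≤⟨ +-monoʳ-≤ (L * (w + 1)) (*-monoˡ-≤ h L≤P) ⟩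
  L * (w + 1) + P * h       ≡⟨ trans (+-comm _ (P * h)) (cong (_+ L * (w + 1)) (*-comm P h)) ⟩
  h * P + L * (w + 1) ∎
  where open ≤-Reasoning

∃-window-multiplier : ∀ b .{{_ : NonZero b}} → 2 ≤ b → ∀ m V (Δ : List ℤ) →
  All (λ δ → δ ≢ ℤ.+ 0 × ∣ δ ∣ ≤ V) Δ → length Δ ≤ b ^ m →
  length Δ < b ^ m ⊎ 3 ≤ length Δ ⊎ (V ≤ 1 × 2 ≤ length Δ) →
  ∃[ k ] ∃[ μ ] μ < b ^ k * b ^ m × All (λ δ → ¬ SmallResidue (b ^ k) (b ^ m) {{m^n≢0 b k}} {{m^n≢0 b m}} δ μ) Δ
∃-window-multiplier b 2≤b m V Δ bounded L≤P cases =
  k , SeparatingMultiplier.∃-separating-multiplier h P w V 1≤w w≤h wV≤h Δ bounded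
        (room-for-union-bound h P w V (length Δ) L≤P PV≤w room cases)
  where
  open ≤-Reasoning
  P = b ^ m
  w = P * suc V
  k = w * (3 + V)
  h = b ^ k
  instance
    _ = m^n≢0 b m
    _ = m^n≢0 b k
  w≤k : w ≤ k
  w≤k = m≤m*n w (3 + V)
  k<h : k < h
  k<h = n<b^n b 2≤b k
  1≤w : 1 ≤ w
  1≤w = *-mono-≤ (m^n>0 b m) (s≤s z≤n)
  w≤h : w ≤ h
  w≤h = ≤-trans w≤k (<⇒≤ k<h)
  wV≤h : w * V ≤ h
  wV≤h = ≤-trans (*-monoʳ-≤ w (m≤n+m V 3)) (<⇒≤ k<h)
  PV≤w : P * V ≤ w
  PV≤w = *-monoʳ-≤ P (n≤1+n V)
  room : w + w + P * V ≤ h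
  room = begin
    w + w + P * V   ≤⟨ +-monoʳ-≤ (w + w) PV≤w ⟩
    w + w + w       ≡⟨ triple w ⟩
    w * 3           ≤⟨ *-monoʳ-≤ w (m≤m+n 3 V) ⟩
    k               <⟨ k<h ⟩
    h ∎
    where
    triple : ∀ x → x + x + x ≡ x * 3
    triple = solve-∀

-- Splitting ℤ_b[D] along the intervals

Between? : ∀ c U x → Dec (c ≤ x × x < U)
Between? c U x = c ≤? x ×-dec x <? U

inInterval? : ∀ c ℓ x → Dec (InInterval c ℓ x)
inInterval? c ℓ x = Between? c (c + ℓ) x

strictlyIncreasing-tail : ∀ {n} {d : Fin (suc n) → ℕ} → StrictlyIncreasing d → StrictlyIncreasing (d ∘ fsuc)
strictlyIncreasing-tail d-inc i j i<j = d-inc (fsuc i) (fsuc j) (s≤s i<j)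

module _ (b : ℕ) .{{_ : NonZero b}} where

  digits-between-bound : ∀ n (d : Fin n → ℕ) → StrictlyIncreasing d → (a : Fin n → ℕ) → (∀ i → a i < b) →
                         ∀ c U → c ≤ U → ∑ n (λ i → indicator (Between? c U (d i)) * (a i * b ^ d i)) + b ^ c ≤ b ^ U
  digits-between-bound zero    d d-inc a a<b c U c≤U = ^-monoʳ-≤ b c≤U
  digits-between-bound (suc n) d d-inc a a<b c U c≤U with Between? c U (d fzero)
  ... | no _ = digits-between-bound n (d ∘ fsuc) (strictlyIncreasing-tail d-inc) (a ∘ fsuc) (a<b ∘ fsuc) c U c≤U
  ... | yes (c≤d₀ , d₀<U) = begin
    1 * (a₀ * b ^ d₀) + R + b ^ c  ≡⟨ cong (_+ b ^ c) (trans (cong (_+ R) (*-identityˡ _)) (+-comm _ R)) ⟩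
    R + a₀ * b ^ d₀ + b ^ c        ≤⟨ +-monoʳ-≤ (R + a₀ * b ^ d₀) (^-monoʳ-≤ b c≤d₀) ⟩
    R + a₀ * b ^ d₀ + b ^ d₀       ≡⟨ trans (+-assoc R _ _) (cong (R +_) (+-comm _ (b ^ d₀))) ⟩
    R + suc a₀ * b ^ d₀            ≤⟨ +-monoʳ-≤ R (*-monoˡ-≤ (b ^ d₀) (a<b fzero)) ⟩
    R + b ^ suc d₀                 ≡⟨ cong (_+ b ^ suc d₀) R≡R′ ⟩
    R′ + b ^ suc d₀                ≤⟨ digits-between-bound n (d ∘ fsuc) (strictlyIncreasing-tail d-inc) (a ∘ fsuc) (a<b ∘ fsuc)
                                                           (suc d₀) U d₀<U ⟩
    b ^ U ∎
    where
    open ≤-Reasoning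
    d₀ = d fzero
    a₀ = a fzero
    R = ∑ n (λ i → indicator (Between? c U (d (fsuc i))) * (a (fsuc i) * b ^ d (fsuc i)))
    R′ = ∑ n (λ i → indicator (Between? (suc d₀) U (d (fsuc i))) * (a (fsuc i) * b ^ d (fsuc i)))
    R≡R′ : R ≡ R′
    R≡R′ = ∑-cong n λ i → cong (_* (a (fsuc i) * b ^ d (fsuc i)))
      (indicator-cong (Between? c U (d (fsuc i))) (Between? (suc d₀) U (d (fsuc i)))
        (λ (_ , dᵢ<U) → d-inc fzero (fsuc i) (s≤s z≤n) , dᵢ<U)
        (λ (_ , dᵢ<U) → ≤-trans c≤d₀ (<⇒≤ (d-inc fzero (fsuc i) (s≤s z≤n))) , dᵢ<U))

Blocked : (b r : ℕ) → (c ℓ : Fin r → ℕ) → ℕ → Set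
Blocked b r c ℓ x = Σ (Fin r → ℕ) λ A → (∀ j → A j < b ^ ℓ j) × x ≡ ∑ r (λ j → A j * b ^ c j)

module _ (b : ℕ) .{{_ : NonZero b}} {n} (d : Fin n → ℕ) (d-inc : StrictlyIncreasing d) {r} (c ℓ : Fin r → ℕ)
         (disjoint : ∀ i j x → i ≢ j → InInterval (c i) (ℓ i) x → ¬ InInterval (c j) (ℓ j) x)
         (covered : ∀ i → ∃[ j ] InInterval (c j) (ℓ j) (d i)) where

  private
    [_∋_] : Fin r → Fin n → ℕ
    [ j ∋ i ] = indicator (inInterval? (c j) (ℓ j) (d i))

    in-one-block : ∀ i → ∑ r (λ j → [ j ∋ i ]) ≡ 1
    in-one-block i with covered i
    ... | j₀ , d∈j₀ = trans (∑-single r _ j₀ λ j j≢j₀ → not-in j (disjoint j₀ j (d i) (j≢j₀ ∘ sym) d∈j₀)) (is-in d∈j₀)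
      where
      not-in : ∀ j → ¬ InInterval (c j) (ℓ j) (d i) → [ j ∋ i ] ≡ 0
      not-in j d∉ with inInterval? (c j) (ℓ j) (d i)
      ... | yes d∈ = contradiction d∈ d∉
      ... | no _   = refl
      is-in : InInterval (c j₀) (ℓ j₀) (d i) → [ j₀ ∋ i ] ≡ 1
      is-in d∈ with inInterval? (c j₀) (ℓ j₀) (d i)
      ... | yes _  = refl
      ... | no d∉ = contradiction d∈ d∉

  InZbD⇒Blocked : ∀ x → InZbD b n d x → Blocked b r c ℓ x
  InZbD⇒Blocked x (a , a<b , refl) = block , block<b^ℓ , blocks-sum
    where
    part : Fin r → ℕ
    part j = ∑ n (λ i → [ j ∋ i ] * (a i * b ^ d i))

    block : Fin r → ℕ
    block j = ∑ n (λ i → [ j ∋ i ] * (a i * b ^ (d i ∸ c j)))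

    block-shift : ∀ j → block j * b ^ c j ≡ part j
    block-shift j = trans (∑-*ʳ n _ (b ^ c j)) (∑-cong n term)
      where
      term : ∀ i → [ j ∋ i ] * (a i * b ^ (d i ∸ c j)) * b ^ c j ≡ [ j ∋ i ] * (a i * b ^ d i)
      term i with inInterval? (c j) (ℓ j) (d i)
      ... | no _ = refl
      ... | yes (cⱼ≤dᵢ , _) = begin
        1 * (a i * b ^ (d i ∸ c j)) * b ^ c j   ≡⟨ cong (_* b ^ c j) (*-identityˡ (a i * b ^ (d i ∸ c j))) ⟩
        a i * b ^ (d i ∸ c j) * b ^ c j         ≡⟨ *-assoc (a i) (b ^ (d i ∸ c j)) (b ^ c j) ⟩
        a i * (b ^ (d i ∸ c j) * b ^ c j)       ≡⟨ cong (a i *_) (^-distribˡ-+-* b (d i ∸ c j) (c j)) ⟨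
        a i * b ^ (d i ∸ c j + c j)             ≡⟨ cong (λ e → a i * b ^ e) (m∸n+n≡m cⱼ≤dᵢ) ⟩
        a i * b ^ d i                           ≡⟨ *-identityˡ (a i * b ^ d i) ⟨
        1 * (a i * b ^ d i) ∎
        where open ≡-Reasoning

    block<b^ℓ : ∀ j → block j < b ^ ℓ j
    block<b^ℓ j = *-cancelʳ-≤ (suc (block j)) (b ^ ℓ j) (b ^ c j) {{m^n≢0 b (c j)}} (begin
      suc (block j) * b ^ c j     ≡⟨ +-comm (b ^ c j) _ ⟩
      block j * b ^ c j + b ^ c j ≡⟨ cong (_+ b ^ c j) (block-shift j) ⟩
      part j + b ^ c j            ≤⟨ digits-between-bound b n d d-inc a a<b (c j) (c j + ℓ j) (m≤m+n (c j) (ℓ j)) ⟩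
      b ^ (c j + ℓ j)             ≡⟨ trans (^-distribˡ-+-* b (c j) (ℓ j)) (*-comm (b ^ c j) _) ⟩
      b ^ ℓ j * b ^ c j ∎)
      where open ≤-Reasoning

    blocks-sum : ∑ n (λ i → a i * b ^ d i) ≡ ∑ r (λ j → block j * b ^ c j)
    blocks-sum = begin
      ∑ n (λ i → a i * b ^ d i)
        ≡⟨ ∑-cong n (λ i → trans (cong (_* (a i * b ^ d i)) (in-one-block i)) (*-identityˡ _)) ⟨
      ∑ n (λ i → ∑ r (λ j → [ j ∋ i ]) * (a i * b ^ d i)) ≡⟨ ∑-cong n (λ i → ∑-*ʳ r _ _) ⟩
      ∑ n (λ i → ∑ r (λ j → [ j ∋ i ] * (a i * b ^ d i))) ≡⟨ ∑-comm r n _ ⟨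
      ∑ r part                                           ≡⟨ ∑-cong r (sym ∘ block-shift) ⟩
      ∑ r (λ j → block j * b ^ c j) ∎
      where open ≡-Reasoning

-- Differences of block sums

length-cartesianProductWith : ∀ {A B C : Set} (f : A → B → C) xs ys →
                              length (cartesianProductWith f xs ys) ≡ length xs * length ys
length-cartesianProductWith f []       ys = refl
length-cartesianProductWith f (x ∷ xs) ys = begin
  length (map (f x) ys ++ cartesianProductWith f xs ys)
    ≡⟨ length-++ (map (f x) ys) ⟩
  length (map (f x) ys) + length (cartesianProductWith f xs ys)
    ≡⟨ cong₂ _+_ (length-map (f x) ys) (length-cartesianProductWith f xs ys) ⟩
  length ys + length xs * length ys ∎
  where open ≡-Reasoning

symmetricRange : ℕ → List ℤ
symmetricRange K = map -[1+_] (upTo K) ++ map ℤ.+_ (upTo (suc K))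

length-symmetricRange : ∀ K → length (symmetricRange K) ≡ K + suc K
length-symmetricRange K = begin
  length (map -[1+_] (upTo K) ++ map ℤ.+_ (upTo (suc K)))
    ≡⟨ length-++ (map -[1+_] (upTo K)) ⟩
  length (map -[1+_] (upTo K)) + length (map ℤ.+_ (upTo (suc K)))
    ≡⟨ cong₂ _+_ (trans (length-map _ (upTo K)) (length-upTo K))
                 (trans (length-map _ (upTo (suc K))) (length-upTo (suc K))) ⟩
  K + suc K ∎
  where open ≡-Reasoning

difference∈symmetricRange : ∀ {N A A′} → A < N → A′ < N → ℤ.+ A ℤ.- ℤ.+ A′ ∈ symmetricRange (N ∸ 1)
difference∈symmetricRange {suc K} {A} {A′} A<N A′<N with ≤-<-connex A′ A
... | inj₁ A′≤A = subst (_∈ symmetricRange K) (sym (trans (ℤP.m-n≡m⊖n A A′) (ℤP.⊖-≥ A′≤A)))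
                    (∈-++⁺ʳ (map -[1+_] (upTo K)) (∈-map⁺ ℤ.+_ (∈-upTo⁺ (≤-<-trans (m∸n≤m A A′) A<N))))
... | inj₂ A<A′ = subst (_∈ symmetricRange K) (sym A-A′≡) (∈-++⁺ˡ (∈-map⁺ -[1+_] (∈-upTo⁺ gap<K)))
  where
  gap<K : A′ ∸ suc A < K
  gap<K = <-≤-trans (∸-monoʳ-< {o = 0} z<s A<A′) (≤-pred A′<N)
  A-A′≡ : ℤ.+ A ℤ.- ℤ.+ A′ ≡ -[1+ A′ ∸ suc A ]
  A-A′≡ = trans (ℤP.m-n≡m⊖n A A′) (trans (ℤP.⊖-< A<A′) (cong (ℤ.-_ ∘ ℤ.+_) (+-∸-assoc 1 A<A′)))

symmetricRange-bound : ∀ K e → e ∈ symmetricRange K → ∣ e ∣ ≤ K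
symmetricRange-bound K e e∈ with ∈-++⁻ (map -[1+_] (upTo K)) e∈
... | inj₁ e∈neg with _ , i∈ , refl ← ∈-map⁻ -[1+_] e∈neg = ∈-upTo⁻ i∈
... | inj₂ e∈pos with _ , i∈ , refl ← ∈-map⁻ ℤ.+_ e∈pos = ≤-pred (∈-upTo⁻ i∈)

module _ (b : ℕ) .{{_ : NonZero b}} where

  blockDifferences : ∀ r → (c ℓ : Fin r → ℕ) → List ℤ
  blockDifferences zero    c ℓ = ℤ.+ 0 ∷ []
  blockDifferences (suc r) c ℓ = cartesianProductWith (λ e v → e ℤ.* ℤ.+ (b ^ c fzero) ℤ.+ v)
                               (symmetricRange (b ^ ℓ fzero ∸ 1)) (blockDifferences r (c ∘ fsuc) (ℓ ∘ fsuc))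

  length-blockDifferences : ∀ r c ℓ → length (blockDifferences r c ℓ) ≡ ∏ r (λ j → 2 * b ^ ℓ j ∸ 1)
  length-blockDifferences zero    c ℓ = refl
  length-blockDifferences (suc r) c ℓ = begin
    length (blockDifferences (suc r) c ℓ)
      ≡⟨ length-cartesianProductWith _ (symmetricRange (N ∸ 1)) (blockDifferences r (c ∘ fsuc) (ℓ ∘ fsuc)) ⟩
    length (symmetricRange (N ∸ 1)) * length (blockDifferences r (c ∘ fsuc) (ℓ ∘ fsuc))
      ≡⟨ cong₂ _*_ (trans (length-symmetricRange (N ∸ 1)) (two-sided N {{m^n≢0 b (ℓ fzero)}}))
                   (length-blockDifferences r (c ∘ fsuc) (ℓ ∘ fsuc)) ⟩
    (2 * N ∸ 1) * ∏ r (λ j → 2 * b ^ ℓ (fsuc j) ∸ 1) ∎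
    where
    open ≡-Reasoning
    N = b ^ ℓ fzero
    two-sided : ∀ N .{{_ : NonZero N}} → N ∸ 1 + suc (N ∸ 1) ≡ 2 * N ∸ 1
    two-sided (suc K) = cong (K +_) (cong suc (sym (+-identityʳ K)))

  ∑-difference∈blockDifferences : ∀ r c ℓ (A A′ : Fin r → ℕ) → (∀ j → A j < b ^ ℓ j) → (∀ j → A′ j < b ^ ℓ j) →
    ℤ.+ ∑ r (λ j → A j * b ^ c j) ℤ.- ℤ.+ ∑ r (λ j → A′ j * b ^ c j) ∈ blockDifferences r c ℓ
  ∑-difference∈blockDifferences zero    c ℓ A A′ A<  A′< = here refl
  ∑-difference∈blockDifferences (suc r) c ℓ A A′ A< A′< =
    subst (_∈ blockDifferences (suc r) c ℓ) (sym split)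
      (∈-cartesianProductWith⁺ _ (difference∈symmetricRange (A< fzero) (A′< fzero))
        (∑-difference∈blockDifferences r (c ∘ fsuc) (ℓ ∘ fsuc) (A ∘ fsuc) (A′ ∘ fsuc) (A< ∘ fsuc) (A′< ∘ fsuc)))
    where
    B = b ^ c fzero
    X = ∑ r (λ j → A (fsuc j) * b ^ c (fsuc j))
    Y = ∑ r (λ j → A′ (fsuc j) * b ^ c (fsuc j))
    split : ℤ.+ (A fzero * B + X) ℤ.- ℤ.+ (A′ fzero * B + Y)
            ≡ (ℤ.+ A fzero ℤ.- ℤ.+ A′ fzero) ℤ.* ℤ.+ B ℤ.+ (ℤ.+ X ℤ.- ℤ.+ Y)
    split = begin
      ℤ.+ (A fzero * B + X) ℤ.- ℤ.+ (A′ fzero * B + Y)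
        ≡⟨ cong₂ ℤ._-_ (trans (ℤP.pos-+ (A fzero * B) X) (cong (ℤ._+ ℤ.+ X) (ℤP.pos-* (A fzero) B)))
                       (trans (ℤP.pos-+ (A′ fzero * B) Y) (cong (ℤ._+ ℤ.+ Y) (ℤP.pos-* (A′ fzero) B))) ⟩
      (ℤ.+ A fzero ℤ.* ℤ.+ B ℤ.+ ℤ.+ X) ℤ.- (ℤ.+ A′ fzero ℤ.* ℤ.+ B ℤ.+ ℤ.+ Y)
        ≡⟨ regroup (ℤ.+ A fzero) (ℤ.+ A′ fzero) (ℤ.+ B) (ℤ.+ X) (ℤ.+ Y) ⟩
      (ℤ.+ A fzero ℤ.- ℤ.+ A′ fzero) ℤ.* ℤ.+ B ℤ.+ (ℤ.+ X ℤ.- ℤ.+ Y) ∎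
      where
      open ≡-Reasoning
      regroup : ∀ a a′ B x y → (a ℤ.* B ℤ.+ x) ℤ.- (a′ ℤ.* B ℤ.+ y) ≡ (a ℤ.- a′) ℤ.* B ℤ.+ (x ℤ.- y)
      regroup = ℤ-Solver.solve-∀

  blockDifferences-bound : ∀ r c ℓ v → v ∈ blockDifferences r c ℓ → ∣ v ∣ ≤ ∑ r (λ j → (b ^ ℓ j ∸ 1) * b ^ c j)
  blockDifferences-bound zero    c ℓ v (here refl) = z≤n
  blockDifferences-bound (suc r) c ℓ v v∈
    with e , v′ , e∈ , v′∈ , refl ←
           ∈-cartesianProductWith⁻ _ (symmetricRange (b ^ ℓ fzero ∸ 1)) (blockDifferences r (c ∘ fsuc) (ℓ ∘ fsuc)) v∈
    = begin
      ∣ e ℤ.* ℤ.+ B ℤ.+ v′ ∣        ≤⟨ ℤP.∣i+j∣≤∣i∣+∣j∣ (e ℤ.* ℤ.+ B) v′ ⟩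
      ∣ e ℤ.* ℤ.+ B ∣ + ∣ v′ ∣      ≡⟨ cong (_+ ∣ v′ ∣) (ℤP.∣i*j∣≡∣i∣*∣j∣ e (ℤ.+ B)) ⟩
      ∣ e ∣ * B + ∣ v′ ∣            ≤⟨ +-mono-≤ (*-monoˡ-≤ B (symmetricRange-bound _ e e∈))
                                               (blockDifferences-bound r (c ∘ fsuc) (ℓ ∘ fsuc) v′ v′∈) ⟩
      (b ^ ℓ fzero ∸ 1) * B + ∑ r (λ j → (b ^ ℓ (fsuc j) ∸ 1) * b ^ c (fsuc j)) ∎
    where
    open ≤-Reasoning
    B = b ^ c fzero

  nonzeroBlockDifferences : ∀ r → (c ℓ : Fin r → ℕ) → List ℤ
  nonzeroBlockDifferences r c ℓ = filter (λ v → ¬? (v ℤ.≟ ℤ.+ 0)) (blockDifferences r c ℓ)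

  length-nonzeroBlockDifferences : ∀ r c ℓ → length (nonzeroBlockDifferences r c ℓ) ≤ ∏ r (λ j → 2 * b ^ ℓ j ∸ 1) ∸ 1
  length-nonzeroBlockDifferences r c ℓ = begin
    length (nonzeroBlockDifferences r c ℓ)          ≡⟨ m+n∸n≡m _ 1 ⟨
    length (nonzeroBlockDifferences r c ℓ) + 1 ∸ 1  ≤⟨ ∸-monoˡ-≤ 1 (≤-trans (≤-reflexive (+-comm _ 1)) shorter) ⟩
    length (blockDifferences r c ℓ) ∸ 1             ≡⟨ cong (_∸ 1) (length-blockDifferences r c ℓ) ⟩
    ∏ r (λ j → 2 * b ^ ℓ j ∸ 1) ∸ 1 ∎
    where
    open ≤-Reasoning
    0∈ : ℤ.+ 0 ∈ blockDifferences r c ℓ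
    0∈ = subst (_∈ blockDifferences r c ℓ) (ℤP.+-inverseʳ (ℤ.+ ∑ r (λ j → 0 * b ^ c j)))
           (∑-difference∈blockDifferences r c ℓ (λ _ → 0) (λ _ → 0) (λ j → m^n>0 b (ℓ j)) (λ j → m^n>0 b (ℓ j)))
    shorter = filter-notAll (λ v → ¬? (v ℤ.≟ ℤ.+ 0)) (blockDifferences r c ℓ) (lose 0∈ (λ 0≢0 → 0≢0 refl))

  nonzeroBlockDifferences-bound : ∀ r c ℓ → All (λ δ → δ ≢ ℤ.+ 0 × ∣ δ ∣ ≤ ∑ r (λ j → (b ^ ℓ j ∸ 1) * b ^ c j))
                                                (nonzeroBlockDifferences r c ℓ)
  nonzeroBlockDifferences-bound r c ℓ = All.tabulate λ δ∈ →
    let (δ∈all , δ≢0) = ∈-filter⁻ (λ v → ¬? (v ℤ.≟ ℤ.+ 0)) δ∈ in δ≢0 , blockDifferences-bound r c ℓ _ δ∈all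

  blocked-difference∈ : ∀ r c ℓ {x y} → Blocked b r c ℓ x → Blocked b r c ℓ y → x ≢ y →
                        ℤ.+ x ℤ.- ℤ.+ y ∈ nonzeroBlockDifferences r c ℓ
  blocked-difference∈ r c ℓ {x} {y} (A , A< , refl) (A′ , A′< , refl) x≢y =
    ∈-filter⁺ (λ v → ¬? (v ℤ.≟ ℤ.+ 0)) (∑-difference∈blockDifferences r c ℓ A A′ A< A′<)
              (x≢y ∘ ℤP.+-injective ∘ ℤP.i-j≡0⇒i≡j (ℤ.+ x) (ℤ.+ y))

2≤b^ℓ : ∀ b → 2 ≤ b → ∀ ℓ → 1 ≤ ℓ → 2 ≤ b ^ ℓ
2≤b^ℓ b 2≤b ℓ 1≤ℓ = begin
  2       ≤⟨ 2≤b ⟩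
  b       ≡⟨ *-identityʳ b ⟨
  b ^ 1   ≤⟨ ^-monoʳ-≤ b {{>-nonZero (≤-trans (s≤s z≤n) 2≤b)}} 1≤ℓ ⟩
  b ^ ℓ ∎
  where open ≤-Reasoning

-- The union bound has no slack only if length Δ = b^m ≤ 2. That forces M = 3, i.e. b = 2 and
-- D = {0}, where V = 1; this is the only use of 0 ∈ D.
product-shape : ∀ b → 2 ≤ b → ∀ r (c ℓ : Fin r → ℕ) → (∀ j → 1 ≤ ℓ j) → ∃[ j ] c j ≡ 0 →
                4 ≤ ∏ r (λ j → 2 * b ^ ℓ j ∸ 1) ⊎ (∏ r (λ j → 2 * b ^ ℓ j ∸ 1) ≡ 3 × ∑ r (λ j → (b ^ ℓ j ∸ 1) * b ^ c j) ≡ 1)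
product-shape b 2≤b (suc zero) c ℓ ℓ≥1 (fzero , c₀≡0) with b ^ ℓ fzero ≤? 2
... | yes b^ℓ≤2 = inj₂ (cong (λ N → (2 * N ∸ 1) * 1) b^ℓ≡2 , cong₂ (λ N e → (N ∸ 1) * b ^ e + 0) b^ℓ≡2 c₀≡0)
  where
  b^ℓ≡2 : b ^ ℓ fzero ≡ 2
  b^ℓ≡2 = ≤-antisym b^ℓ≤2 (2≤b^ℓ b 2≤b (ℓ fzero) (ℓ≥1 fzero))
... | no  b^ℓ≰2 = inj₁ (begin
  4                             ≤⟨ m≤m+n 4 1 ⟩
  2 * 3 ∸ 1                     ≤⟨ ∸-monoˡ-≤ 1 (*-monoʳ-≤ 2 (≰⇒> b^ℓ≰2)) ⟩
  2 * b ^ ℓ fzero ∸ 1           ≡⟨ *-identityʳ _ ⟨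
  (2 * b ^ ℓ fzero ∸ 1) * 1 ∎)
  where open ≤-Reasoning
product-shape b 2≤b (suc (suc r)) c ℓ ℓ≥1 _ =
  inj₁ (≤-trans (m≤m+n 4 5) (*-mono-≤ (3≤factor fzero) (*-mono-≤ (3≤factor (fsuc fzero))
                                        (1≤∏ r _ (λ j → ≤-trans (s≤s z≤n) (3≤factor (fsuc (fsuc j))))))))
  where
  3≤factor : ∀ j → 3 ≤ 2 * b ^ ℓ j ∸ 1
  3≤factor j = ∸-monoˡ-≤ 1 (*-monoʳ-≤ 2 (2≤b^ℓ b 2≤b (ℓ j) (ℓ≥1 j)))

union-bound-applies : ∀ L M P V → L ≤ M ∸ 1 → M ∸ 1 ≤ P → 4 ≤ M ⊎ (M ≡ 3 × V ≡ 1) →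
                      L < P ⊎ 3 ≤ L ⊎ (V ≤ 1 × 2 ≤ L)
union-bound-applies L M P V L≤M-1 M-1≤P (inj₁ 4≤M) with 3 ≤? L
... | yes 3≤L = inj₂ (inj₁ 3≤L)
... | no  3≰L = inj₁ (<-≤-trans (≰⇒> 3≰L) (≤-trans (∸-monoˡ-≤ 1 4≤M) M-1≤P))
union-bound-applies L M P V L≤M-1 M-1≤P (inj₂ (refl , refl)) with 2 ≤? L
... | yes 2≤L = inj₂ (inj₂ (≤-refl , 2≤L))
... | no  2≰L = inj₁ (<-≤-trans (≰⇒> 2≰L) M-1≤P)

module _ (b : ℕ) .{{_ : NonZero b}} {n} (d : Fin n → ℕ) (d-inc : StrictlyIncreasing d) {r} (c ℓ : Fin r → ℕ)
         (disjoint : ∀ i j x → i ≢ j → InInterval (c i) (ℓ i) x → ¬ InInterval (c j) (ℓ j) x)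
         (covered : ∀ i → ∃[ j ] InInterval (c j) (ℓ j) (d i))
         (k m μ : ℕ) (μ<B : μ < b ^ k * b ^ m)
         (separated : All (λ δ → ¬ SmallResidue (b ^ k) (b ^ m) {{m^n≢0 b k}} {{m^n≢0 b m}} δ μ)
                          (nonzeroBlockDifferences b r c ℓ)) where

  private instance
    b^k-nonZero = m^n≢0 b k
    b^m-nonZero = m^n≢0 b m

  no-collision : ∀ x y → InZbD b n d x → InZbD b n d y → dig b (x * μ) k m ≡ dig b (y * μ) k m → ¬ y < x
  no-collision x y x∈ y∈ same y<x =
    [ not-small x∈ y∈ (>⇒≢ y<x) x-y≡ , not-small y∈ x∈ (<⇒≢ y<x) y-x≡ ]
      (same-window⇒small-residue (b ^ k) (b ^ m) x y t μ (<⇒≤ μ<B) x≡y+t+1 (dig⇒window≡ b (x * μ) (y * μ) k m same))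
    where
    not-small : ∀ {x y δ} → InZbD b n d x → InZbD b n d y → x ≢ y → ℤ.+ x ℤ.- ℤ.+ y ≡ δ →
                ¬ SmallResidue (b ^ k) (b ^ m) δ μ
    not-small x∈ y∈ x≢y refl = All.lookup separated
      (blocked-difference∈ b r c ℓ (InZbD⇒Blocked b d d-inc c ℓ disjoint covered _ x∈)
                                   (InZbD⇒Blocked b d d-inc c ℓ disjoint covered _ y∈) x≢y)
    t = x ∸ suc y
    x∸y≡ : x ∸ y ≡ suc t
    x∸y≡ = +-∸-assoc 1 y<x
    x≡y+t+1 : x ≡ y + suc t
    x≡y+t+1 = sym (trans (+-suc y t) (m+[n∸m]≡n y<x))
    x-y≡ : ℤ.+ x ℤ.- ℤ.+ y ≡ ℤ.+ suc t
    x-y≡ = trans (ℤP.m-n≡m⊖n x y) (trans (ℤP.⊖-≥ (<⇒≤ y<x)) (cong ℤ.+_ x∸y≡))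
    y-x≡ : ℤ.+ y ℤ.- ℤ.+ x ≡ -[1+ t ]
    y-x≡ = trans (ℤP.m-n≡m⊖n y x) (trans (ℤP.⊖-< y<x) (cong (ℤ.-_ ∘ ℤ.+_) x∸y≡))

  separated⇒dig-injective : DigInjective b n d m μ k
  separated⇒dig-injective x y x∈ y∈ same with <-cmp x y
  ... | tri< x<y _ _ = contradiction x<y (no-collision y x y∈ x∈ (sym same))
  ... | tri≈ _ x≡y _ = x≡y
  ... | tri> _ _ y<x = contradiction y<x (no-collision x y x∈ y∈ same)

dig-injective-for-intervals :
  ∀ b → 2 ≤ b → ∀ n (d : Fin n → ℕ) → StrictlyIncreasing d →
  ∀ r (c ℓ : Fin r → ℕ) → (∀ j → 1 ≤ ℓ j) →
  (∀ i j x → i ≢ j → InInterval (c i) (ℓ i) x → ¬ InInterval (c j) (ℓ j) x) →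
  (∀ i → ∃[ j ] InInterval (c j) (ℓ j) (d i)) → ∃[ j ] InInterval (c j) (ℓ j) 0 →
  ∀ m → ∏ r (λ j → 2 * b ^ ℓ j ∸ 1) ∸ 1 ≤ b ^ m → ∃[ μ ] ∃[ k ] DigInjective b n d m μ k
dig-injective-for-intervals b@(suc (suc _)) 2≤b@(s≤s (s≤s z≤n)) n d d-inc r c ℓ ℓ≥1 disjoint covered (j₀ , c≤0 , _) m M-1≤P =
  let k , μ , μ<B , separated = ∃-window-multiplier b 2≤b m V Δ (nonzeroBlockDifferences-bound b r c ℓ) L≤P shape
  in  μ , k , separated⇒dig-injective b d d-inc c ℓ disjoint covered k m μ μ<B separated
  where
  M = ∏ r (λ j → 2 * b ^ ℓ j ∸ 1)
  V = ∑ r (λ j → (b ^ ℓ j ∸ 1) * b ^ c j)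
  Δ = nonzeroBlockDifferences b r c ℓ
  L≤M-1 : length Δ ≤ M ∸ 1
  L≤M-1 = length-nonzeroBlockDifferences b r c ℓ
  L≤P : length Δ ≤ b ^ m
  L≤P = ≤-trans L≤M-1 M-1≤P
  shape : length Δ < b ^ m ⊎ 3 ≤ length Δ ⊎ (V ≤ 1 × 2 ≤ length Δ)
  shape = union-bound-applies (length Δ) M (b ^ m) V L≤M-1 M-1≤P (product-shape b 2≤b r c ℓ ℓ≥1 (j₀ , n≤0⇒n≡0 c≤0))

strictlyIncreasing⇒injective : ∀ {n} {d : Fin n → ℕ} → StrictlyIncreasing d → ∀ i j → d i ≡ d j → i ≡ j
strictlyIncreasing⇒injective d-inc i j dᵢ≡dⱼ with FinP.<-cmp i j
... | tri< i<j _ _ = contradiction dᵢ≡dⱼ (<⇒≢ (d-inc i j i<j))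
... | tri≈ _ i≡j _ = i≡j
... | tri> _ _ j<i = contradiction dᵢ≡dⱼ (>⇒≢ (d-inc j i j<i))

∈-singleton : ∀ c → InInterval c 1 c
∈-singleton c = ≤-refl , m<m+n c z<s

singleton-∋⇒≡ : ∀ {c x} → InInterval c 1 x → x ≡ c
singleton-∋⇒≡ {c} {x} (c≤x , x<c+1) = ≤-antisym (≤-pred (subst (x <_) (+-comm c 1) x<c+1)) c≤x

singletons-disjoint : ∀ {n} {d : Fin n → ℕ} → StrictlyIncreasing d →
                      ∀ i j x → i ≢ j → InInterval (d i) 1 x → ¬ InInterval (d j) 1 x
singletons-disjoint d-inc i j x i≢j x∈i x∈j =
  i≢j (strictlyIncreasing⇒injective d-inc i j (trans (sym (singleton-∋⇒≡ x∈i)) (singleton-∋⇒≡ x∈j)))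

∏-singletons : ∀ b n → ∏ n (λ _ → 2 * b ^ 1 ∸ 1) ≡ (2 * b ∸ 1) ^ n
∏-singletons b n = trans (∏-const n _) (cong (λ x → (2 * x ∸ 1) ^ n) (*-identityʳ b))

theorem3 : (b : ℕ) → 2 ≤ b → (n : ℕ) → (0<n : 0 < n) → (d : Fin n → ℕ)
           → d (fromℕ< 0<n) ≡ 0 → StrictlyIncreasing d
           → ((m : ℕ) → IsCeilLog b ((2 * b ∸ 1) ^ n ∸ 1) m
               → ∃[ μ ] ∃[ k ] DigInjective b n d m μ k)
           × ((r : ℕ) → (c ℓ : Fin r → ℕ) → (∀ i → 1 ≤ ℓ i)
               → (∀ i j x → i ≢ j → InInterval (c i) (ℓ i) x → ¬ InInterval (c j) (ℓ j) x)
               → (∀ x → InD d x ⇔ (∃[ i ] InInterval (c i) (ℓ i) x))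
               → (m : ℕ) → IsCeilLog b (∏ r (λ i → 2 * b ^ ℓ i ∸ 1) ∸ 1) m
               → ∃[ μ ] ∃[ k ] DigInjective b n d m μ k)
theorem3 b 2≤b n 0<n d d₀≡0 d-inc =
  (λ m (M-1≤b^m , _) →
    dig-injective-for-intervals b 2≤b n d d-inc n d (λ _ → 1) (λ _ → ≤-refl) (singletons-disjoint d-inc)
      (λ i → i , ∈-singleton (d i)) (fromℕ< 0<n , subst (λ c → InInterval c 1 0) (sym d₀≡0) (∈-singleton 0))
      m (subst (λ M → M ∸ 1 ≤ b ^ m) (sym (∏-singletons b n)) M-1≤b^m))
  ,
  (λ r c ℓ ℓ≥1 disjoint D≡⋃intervals m (M-1≤b^m , _) →
    dig-injective-for-intervals b 2≤b n d d-inc r c ℓ ℓ≥1 disjoint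
      (λ i → Equivalence.to (D≡⋃intervals (d i)) (i , refl))
      (Equivalence.to (D≡⋃intervals 0) (fromℕ< 0<n , sym d₀≡0)) m M-1≤b^m)
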